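{- For every integer $d\ge 1$ define column vectors $\mathbf{c}_d=(c(d,d),c(d,d-1),\dots,c(d,1),c(d,0))^{T}\in\mathbb{Q}^{d+1}$ by $\mathbf{c}_1=(1,1)^T$ and $$\mathbf{c}_d=M_{d-1}^{d}M_{d-2}^{d-1}\cdots M_2^3M_1^2\,\mathbf{c}_1\quad(d\ge 2),$$ where, for $e\ge 1$, $M_e^{e+1}$ is the $(e+2)\times(e+1)$ rational matrix whose rows are indexed (top to bottom) by $m=e+1,e,\dots,1,0$ and whose columns are indexed (left to right) by $p=e,e-1,\dots,1,0$, with entries - $(M_e^{e+1})_{m,p}=\dfrac{2}{m}$ if $m\ge 1$ and $p=m-1$; - $(M_e^{e+1})_{m,p}=\dfrac{2B_{p+1-m}}{p+1}\dbinom{p+1}{p+1-m}$ if $m\ge 1$ and $p\ge m+1$; - $(M_e^{e+1})_{0,0}=1$; - all other entries equal to $0$. Then for all integers $d\ge1$ and $n\ge 0$, $$|P_n^d|=\mathbf{c}_d\cdot\mathbf{n}_d=\sum_{p=0}^{d}c(d,p)\,n^p,\qquad \mathbf{n}_d=(n^d,n^{d-1},\dots,n,1)^T.$$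
   Context: For integers $d\ge 1$ and $n\ge 0$, let $e_1,\dots,e_d$ be the standard unit vectors of $\mathbb{Z}^d$ and let $P_n^d=\{X_1+X_2+\cdots+X_n : X_i\in\{\pm e_1,\dots,\pm e_d\}\text{ for } i=1,\dots,n\}\subseteq\mathbb{Z}^d$ be the set of possible positions of a nearest-neighbour walk in $\mathbb{Z}^d$ starting at the origin after exactly $n$ unit steps (so $P_0^d=\{0\}$); $|P_n^d|$ is its cardinality. $B_r$ denotes the $r$-th Bernoulli number, defined by $\frac{t}{e^t-1}=\sum_{r\ge0}B_r\frac{t^r}{r!}$ (only $B_r$ with $r\ge 2$ occur above, e.g. $B_2=1/6$, $B_3=0$). -}

module Defs where

open import Data.Nat as ℕ using (ℕ; zero; suc; _≤_; _<_; _≟_; _≤?_)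
open import Data.Nat.Combinatorics using (_C_)
open import Data.Integer as ℤ using (ℤ; +_)
open import Data.Rational as ℚ using (ℚ; _+_; _*_; -_; _/_)
open import Data.Fin as Fin using (Fin)
open import Data.Bool using (Bool; true; false; if_then_else_)
open import Data.Vec as Vec using (Vec; []; _∷_; _∷ʳ_; lookup; tabulate; replicate; zipWith; foldr)
open import Data.Product using (Σ; _×_; _,_)
open import Relation.Nullary using (yes; no)
open import Relation.Binary.PropositionalEquality using (_≡_)

sumTo : ℕ → (ℕ → ℚ) → ℚ
sumTo zero    f = f 0
sumTo (suc n) f = sumTo n f + f (suc n)

ℕ→ℚ : ℕ → ℚ
ℕ→ℚ k = (+ k) / 1

-- Bernoulli numbers (convention B₁ = -1/2, from t/(e^t-1)), via the
-- standard recursion  Σ_{k=0}^{m} C(m+1,k) B_k = 0  for m ≥ 1, B₀ = 1.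
-- bernoullis n = (B₀, …, Bₙ)
bernoullis : (n : ℕ) → Vec ℚ (suc n)
bernoullis zero    = ℚ.1ℚ ∷ []
bernoullis (suc n) = bs ∷ʳ next
  where
  bs : Vec ℚ (suc n)
  bs = bernoullis n
  next : ℚ
  next = - (((+ 1) / (suc (suc n))) *
              foldr (λ _ → ℚ) _+_ ℚ.0ℚ
                (tabulate (λ (k : Fin (suc n)) →
                   ℕ→ℚ (suc (suc n) C Fin.toℕ k) * lookup bs k)))

B : ℕ → ℚ
B n = lookup (bernoullis n) (Fin.fromℕ n)

-- Entry (m,p) of the matrix M_e^{e+1} (rows m = e+1,…,0; columns p = e,…,0).
-- The entries do not depend on e (only the index ranges do).
M : (e m p : ℕ) → ℚ
M e zero    zero    = ℚ.1ℚ
M e zero    (suc p) = ℚ.0ℚ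
M e (suc m) p with p ≟ m
... | yes _ = (+ 2) / (suc m)
... | no _ with suc (suc m) ≤? p
...   | yes _ = (((+ 2) / (suc p)) * B (suc p ℕ.∸ suc m)) * ℕ→ℚ (suc p C (suc p ℕ.∸ suc m))
...   | no _  = ℚ.0ℚ

-- c k p = c(k+1, p): coefficients of the vector c_{k+1} (for 0 ≤ p ≤ k+1).
-- c_1 = (1,1)ᵀ, and c_{e+1} = M_e^{e+1} c_e, i.e.
-- c(e+1, m) = Σ_{p=0}^{e} (M_e^{e+1})_{m,p} c(e,p).
c' : ℕ → ℕ → ℚ
c' zero    p = if (p ℕ.≤ᵇ 1) then ℚ.1ℚ else ℚ.0ℚ
c' (suc k) m = sumTo (suc k) (λ p → M (suc k) m p * c' k p)

c : (d : ℕ) → .{{ℕ.NonZero d}} → ℕ → ℚ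
c (suc k) p = c' k p

Vecℤ : ℕ → Set
Vecℤ d = Vec ℤ d

-- a step ±e_i : index i and sign (true = +, false = -)
Step : ℕ → Set
Step d = Fin d × Bool

stepVec : {d : ℕ} → Step d → Vecℤ d
stepVec {d} (i , s) =
  tabulate (λ j → if Fin.toℕ j ℕ.≡ᵇ Fin.toℕ i then (if s then + 1 else ℤ.-[1+ 0 ]) else + 0)

endpoint : {d n : ℕ} → Vec (Step d) n → Vecℤ d
endpoint {d} = foldr (λ _ → Vecℤ d) (λ s acc → zipWith ℤ._+_ (stepVec s) acc) (replicate _ (+ 0))

InP : (d n : ℕ) → Vecℤ d → Set
InP d n x = Σ (Vec (Step d) n) (λ steps → endpoint steps ≡ x)

-- A point x ∈ ℤᵈ (d ≥ 1) is the end of a walk of exactly n unit steps iff ‖x‖₁ ≤ n and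
-- ‖x‖₁ ≡ n (mod 2). Sorting these points by their first coordinate t (either t = 0, or
-- |t| = j + 1 and the remaining coordinates form such a point for n − j − 1) shows that
-- N(d, n) = |Pₙᵈ| satisfies N(d + 1, n) = N(d, n) + 2 Σ_{r<n} N(d, r), with N(1, n) = n + 1.
-- On the other side, column p of M is x ↦ xᵖ + (2 / (p + 1)) (B_{p+1}(x) − B_{p+1}) in terms of
-- the Bernoulli polynomial B_{p+1}(x); as B_{p+1}(x + 1) − B_{p+1}(x) = (p + 1) xᵖ, it evaluates
-- at n to nᵖ + 2 Σ_{i<n} iᵖ (Faulhaber). Hence c_{d+1} · n_{d+1} = Σ_p c(d, p) (nᵖ + 2 Σ_{i<n} iᵖ)
-- obeys the same recursion as N(d + 1, n), and both equal n + 1 for d = 1.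

{-# OPTIONS --safe #-}
module Submission where

open import Defs
open import Data.Nat using (ℕ; NonZero; _^_)
open import Data.Rational using (ℚ; _*_)
open import Data.List using (List; length)
open import Data.List.Relation.Unary.Unique.Propositional using (Unique)
open import Data.List.Membership.Propositional using (_∈_)
open import Data.Product using (Σ; _×_)
open import Function.Bundles using (_⇔_)
open import Relation.Binary.PropositionalEquality using (_≡_)

open import Algebra.Bundles using (CommutativeRing)
open import Data.Bool using (Bool; true; false; if_then_else_)
open import Data.Empty using (⊥-elim)
import Data.Fin as Fin
import Data.Fin.Properties as Fin
open import Data.Fin.Relation.Unary.Top using (view; ‵fromℕ; ‵inject₁)
open import Data.Integer as ℤ using (ℤ; +_; -[1+_])
import Data.Integer.Properties as ℤ
open import Data.List as List using ([]; _∷_; _++_; map)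
import Data.List.Properties as List
open import Data.List.Membership.Propositional.Properties using (∈-map⁺; ∈-map⁻; ∈-++⁺ˡ; ∈-++⁺ʳ; ∈-++⁻)
open import Data.List.Relation.Binary.Disjoint.Propositional using (Disjoint)
open import Data.List.Relation.Unary.All using ([])
open import Data.List.Relation.Unary.AllPairs using ([]; _∷_)
open import Data.List.Relation.Unary.Any using (here)
import Data.List.Relation.Unary.Unique.Propositional.Properties as Unique
open import Data.Nat as ℕ using (zero; suc; _≤_; _<_; _∸_; _≡ᵇ_; _≤?_; z≤n; s≤s; _!)
import Data.Nat.Properties as ℕ
open import Data.Nat.Combinatorics
  using (_C_; nCn≡1; nC1≡n; k>n⇒nCk≡0; nCk≡nC[n∸k]; nCk≡n!/k![n-k]!; k![n∸k]!∣n!)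
open import Data.Nat.DivMod using (m/n*n≡m)
open import Data.Nat.Tactic.RingSolver using (solve-∀)
open import Data.Product using (∃-syntax; _,_; proj₁; proj₂)
open import Data.Rational as ℚ using (_+_; _-_; -_; _/_; 0ℚ; 1ℚ)
import Data.Rational.Properties as ℚ
open import Data.Rational.Solver using (module +-*-Solver)
import Data.Rational.Unnormalised as ℚᵘ
import Data.Rational.Unnormalised.Properties as ℚᵘ
open import Data.Sum using (_⊎_; inj₁; inj₂)
open import Data.Vec as Vec using (Vec; []; _∷_; _∷ʳ_; lookup; replicate; tabulate; zipWith)
open import Data.Vec.Properties using (tabulate-cong; ∷-injective; ∷-injectiveʳ)
open import Function using (_∘_; mk⇔; Equivalence)
import Function.Properties.Equivalence as ⇔
open import Relation.Binary.PropositionalEquality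
  using (_≢_; refl; sym; trans; cong; cong₂; subst; module ≡-Reasoning)
open import Relation.Nullary using (yes; no; contradiction)

open import Algebra.Definitions.RawSemiring ℚ.+-*-rawSemiring using () renaming (_^_ to _^ℚ_; _×_ to _×ℚ_)
import Algebra.Definitions.RawMonoid ℚ.+-0-rawMonoid as ℚ-Sum
import Algebra.Properties.CommutativeSemiring.Binomial
  (CommutativeRing.commutativeSemiring ℚ.+-*-commutativeRing) as Binomial

open +-*-Solver

toℚᵘ-ℕ→ℚ : ∀ n → ℚ.toℚᵘ (ℕ→ℚ n) ℚᵘ.≃ ℚᵘ.mkℚᵘ (+ n) 0
toℚᵘ-ℕ→ℚ n = ℚ.toℚᵘ-fromℚᵘ (ℚᵘ.mkℚᵘ (+ n) 0)

ℕ→ℚ-+ : ∀ m n → ℕ→ℚ (m ℕ.+ n) ≡ ℕ→ℚ m + ℕ→ℚ n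
ℕ→ℚ-+ m n = ℚ.toℚᵘ-injective (begin
  ℚ.toℚᵘ (ℕ→ℚ (m ℕ.+ n))                     ≈⟨ toℚᵘ-ℕ→ℚ (m ℕ.+ n) ⟩
  ℚᵘ.mkℚᵘ (+ (m ℕ.+ n)) 0                     ≈⟨ ℚᵘ.*≡* (cong (ℤ._* + 1) eq) ⟩
  ℚᵘ.mkℚᵘ (+ m) 0 ℚᵘ.+ ℚᵘ.mkℚᵘ (+ n) 0       ≈⟨ ℚᵘ.+-cong (toℚᵘ-ℕ→ℚ m) (toℚᵘ-ℕ→ℚ n) ⟨
  ℚ.toℚᵘ (ℕ→ℚ m) ℚᵘ.+ ℚ.toℚᵘ (ℕ→ℚ n)        ≈⟨ ℚ.toℚᵘ-homo-+ (ℕ→ℚ m) (ℕ→ℚ n) ⟨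
  ℚ.toℚᵘ (ℕ→ℚ m + ℕ→ℚ n)                     ∎)
  where
  open ℚᵘ.≃-Reasoning
  eq : + (m ℕ.+ n) ≡ + m ℤ.* + 1 ℤ.+ + n ℤ.* + 1
  eq = sym (cong₂ ℤ._+_ (ℤ.*-identityʳ (+ m)) (ℤ.*-identityʳ (+ n)))

ℕ→ℚ-* : ∀ m n → ℕ→ℚ (m ℕ.* n) ≡ ℕ→ℚ m * ℕ→ℚ n
ℕ→ℚ-* m n = ℚ.toℚᵘ-injective (begin
  ℚ.toℚᵘ (ℕ→ℚ (m ℕ.* n))                     ≈⟨ toℚᵘ-ℕ→ℚ (m ℕ.* n) ⟩
  ℚᵘ.mkℚᵘ (+ (m ℕ.* n)) 0                     ≈⟨ ℚᵘ.*≡* (cong (ℤ._* + 1) (ℤ.pos-* m n)) ⟩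
  ℚᵘ.mkℚᵘ (+ m) 0 ℚᵘ.* ℚᵘ.mkℚᵘ (+ n) 0       ≈⟨ ℚᵘ.*-cong (toℚᵘ-ℕ→ℚ m) (toℚᵘ-ℕ→ℚ n) ⟨
  ℚ.toℚᵘ (ℕ→ℚ m) ℚᵘ.* ℚ.toℚᵘ (ℕ→ℚ n)        ≈⟨ ℚ.toℚᵘ-homo-* (ℕ→ℚ m) (ℕ→ℚ n) ⟨
  ℚ.toℚᵘ (ℕ→ℚ m * ℕ→ℚ n)                     ∎)
  where open ℚᵘ.≃-Reasoning

ℕ→ℚ-suc : ∀ n → ℕ→ℚ (suc n) ≡ ℕ→ℚ n + 1ℚ
ℕ→ℚ-suc n = trans (cong ℕ→ℚ (ℕ.+-comm 1 n)) (ℕ→ℚ-+ n 1)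

i/n*n≡i : ∀ i n → (i / suc n) * ℕ→ℚ (suc n) ≡ i / 1
i/n*n≡i i n = ℚ.toℚᵘ-injective (begin
  ℚ.toℚᵘ ((i / suc n) * ℕ→ℚ (suc n))                         ≈⟨ ℚ.toℚᵘ-homo-* (i / suc n) (ℕ→ℚ (suc n)) ⟩
  ℚ.toℚᵘ (i / suc n) ℚᵘ.* ℚ.toℚᵘ (ℕ→ℚ (suc n))              ≈⟨ ℚᵘ.*-cong (ℚ.toℚᵘ-fromℚᵘ (ℚᵘ.mkℚᵘ i n)) (toℚᵘ-ℕ→ℚ (suc n)) ⟩
  ℚᵘ.mkℚᵘ i n ℚᵘ.* ℚᵘ.mkℚᵘ (+ suc n) 0                      ≈⟨ ℚᵘ.*≡* eq ⟩
  ℚᵘ.mkℚᵘ i 0                                                ≈⟨ ℚ.toℚᵘ-fromℚᵘ (ℚᵘ.mkℚᵘ i 0) ⟨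
  ℚ.toℚᵘ (i / 1)                                             ∎)
  where
  open ℚᵘ.≃-Reasoning
  eq : (i ℤ.* + suc n) ℤ.* + 1 ≡ i ℤ.* + suc (n ℕ.* 1)
  eq = trans (ℤ.*-identityʳ _) (cong (λ k → i ℤ.* + suc k) (sym (ℕ.*-identityʳ n)))

Σ< : ℕ → (ℕ → ℚ) → ℚ
Σ< zero    f = 0ℚ
Σ< (suc n) f = Σ< n f + f n

sumTo≡Σ< : ∀ n f → sumTo n f ≡ Σ< (suc n) f
sumTo≡Σ< zero    f = sym (ℚ.+-identityˡ (f 0))
sumTo≡Σ< (suc n) f = cong (_+ f (suc n)) (sumTo≡Σ< n f)

Σ<-cong : ∀ n {f g : ℕ → ℚ} → (∀ i → i < n → f i ≡ g i) → Σ< n f ≡ Σ< n g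
Σ<-cong zero    f≗g = refl
Σ<-cong (suc n) f≗g = cong₂ _+_ (Σ<-cong n (λ i i<n → f≗g i (ℕ.m<n⇒m<1+n i<n))) (f≗g n ℕ.≤-refl)

Σ<-zero : ∀ n {f : ℕ → ℚ} → (∀ i → i < n → f i ≡ 0ℚ) → Σ< n f ≡ 0ℚ
Σ<-zero zero    f≗0 = refl
Σ<-zero (suc n) f≗0 = cong₂ _+_ (Σ<-zero n (λ i i<n → f≗0 i (ℕ.m<n⇒m<1+n i<n))) (f≗0 n ℕ.≤-refl)

Σ<-distrib-+ : ∀ n (f g : ℕ → ℚ) → Σ< n (λ i → f i + g i) ≡ Σ< n f + Σ< n g
Σ<-distrib-+ zero    f g = refl
Σ<-distrib-+ (suc n) f g = trans (cong (_+ (f n + g n)) (Σ<-distrib-+ n f g))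
  (solve 4 (λ a b c d → (a :+ b) :+ (c :+ d) := (a :+ c) :+ (b :+ d)) refl (Σ< n f) (Σ< n g) (f n) (g n))

*-distribˡ-Σ< : ∀ n a (f : ℕ → ℚ) → a * Σ< n f ≡ Σ< n (λ i → a * f i)
*-distribˡ-Σ< zero    a f = ℚ.*-zeroʳ a
*-distribˡ-Σ< (suc n) a f = trans (ℚ.*-distribˡ-+ a (Σ< n f) (f n)) (cong (_+ a * f n) (*-distribˡ-Σ< n a f))

*-distribʳ-Σ< : ∀ n a (f : ℕ → ℚ) → Σ< n f * a ≡ Σ< n (λ i → f i * a)
*-distribʳ-Σ< n a f = trans (ℚ.*-comm (Σ< n f) a)
  (trans (*-distribˡ-Σ< n a f) (Σ<-cong n (λ i _ → ℚ.*-comm a (f i))))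

Σ<-comm : ∀ m n (f : ℕ → ℕ → ℚ) → Σ< m (λ i → Σ< n (f i)) ≡ Σ< n (λ j → Σ< m (λ i → f i j))
Σ<-comm zero    n f = sym (Σ<-zero n (λ _ _ → refl))
Σ<-comm (suc m) n f = trans (cong (_+ Σ< n (f m)) (Σ<-comm m n f)) (sym (Σ<-distrib-+ n _ (f m)))

Σ<-front : ∀ n (f : ℕ → ℚ) → Σ< (suc n) f ≡ f 0 + Σ< n (f ∘ suc)
Σ<-front zero    f = ℚ.+-comm 0ℚ (f 0)
Σ<-front (suc n) f = trans (cong (_+ f (suc n)) (Σ<-front n f)) (ℚ.+-assoc (f 0) _ _)

Σ<-split : ∀ m n (f : ℕ → ℚ) → Σ< (m ℕ.+ n) f ≡ Σ< m f + Σ< n (λ i → f (m ℕ.+ i))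
Σ<-split zero    n f = sym (ℚ.+-identityˡ _)
Σ<-split (suc m) n f = begin
  Σ< (suc (m ℕ.+ n)) f                                       ≡⟨ Σ<-front (m ℕ.+ n) f ⟩
  f 0 + Σ< (m ℕ.+ n) (f ∘ suc)                               ≡⟨ cong (_+_ (f 0)) (Σ<-split m n (f ∘ suc)) ⟩
  f 0 + (Σ< m (f ∘ suc) + Σ< n (λ i → f (suc m ℕ.+ i)))      ≡⟨ ℚ.+-assoc (f 0) _ _ ⟨
  (f 0 + Σ< m (f ∘ suc)) + Σ< n (λ i → f (suc m ℕ.+ i))      ≡⟨ cong (_+ Σ< n (λ i → f (suc m ℕ.+ i))) (Σ<-front m f) ⟨
  Σ< (suc m) f + Σ< n (λ i → f (suc m ℕ.+ i))                ∎
  where open ≡-Reasoning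

Σ<-extend : ∀ {m n} (f : ℕ → ℚ) → m ≤ n → (∀ i → m ≤ i → f i ≡ 0ℚ) → Σ< n f ≡ Σ< m f
Σ<-extend {n = zero}  f z≤n f≗0 = refl
Σ<-extend {m} {n = suc n} f m≤1+n f≗0 with ℕ.m≤n⇒m<n∨m≡n m≤1+n
... | inj₂ refl  = refl
... | inj₁ m<1+n = begin
  Σ< n f + f n     ≡⟨ cong₂ _+_ (Σ<-extend f m≤n f≗0) (f≗0 n m≤n) ⟩
  Σ< m f + 0ℚ      ≡⟨ ℚ.+-identityʳ _ ⟩
  Σ< m f           ∎
  where
  open ≡-Reasoning
  m≤n = ℕ.≤-pred m<1+n

Σ<-reverse : ∀ n (f : ℕ → ℚ) → Σ< n (λ j → f (n ∸ suc j)) ≡ Σ< n f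
Σ<-reverse zero    f = refl
Σ<-reverse (suc n) f = begin
  Σ< (suc n) (λ j → f (n ∸ j))       ≡⟨ Σ<-front n _ ⟩
  f n + Σ< n (λ j → f (n ∸ suc j))   ≡⟨ cong (_+_ (f n)) (Σ<-reverse n f) ⟩
  f n + Σ< n f                       ≡⟨ ℚ.+-comm (f n) _ ⟩
  Σ< n f + f n                       ∎
  where open ≡-Reasoning

δ : ℕ → ℕ → ℚ
δ i j = if i ≡ᵇ j then 1ℚ else 0ℚ

δ-refl : ∀ i → δ i i ≡ 1ℚ
δ-refl zero    = refl
δ-refl (suc i) = δ-refl i

δ-≢ : ∀ {i j} → i ≢ j → δ i j ≡ 0ℚ
δ-≢ {zero}  {zero}  i≢j = contradiction refl i≢j
δ-≢ {zero}  {suc j} i≢j = refl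
δ-≢ {suc i} {zero}  i≢j = refl
δ-≢ {suc i} {suc j} i≢j = δ-≢ (i≢j ∘ cong suc)

δ-∸ : ∀ n i → δ (n ∸ i) 1 ≡ δ (suc i) n
δ-∸ zero          zero    = refl
δ-∸ (suc zero)    zero    = refl
δ-∸ (suc (suc n)) zero    = refl
δ-∸ zero          (suc i) = refl
δ-∸ (suc n)       (suc i) = δ-∸ n i

Σ<-δ : ∀ n {j} (f : ℕ → ℚ) → j < n → Σ< n (λ i → δ i j * f i) ≡ f j
Σ<-δ (suc n) {j} f j<1+n with j ℕ.≟ n
... | yes refl = begin
  Σ< n (λ i → δ i j * f i) + δ j j * f j  ≡⟨ cong₂ _+_ (Σ<-zero n (λ i i<j → off (ℕ.<⇒≢ i<j))) (cong (_* f j) (δ-refl j)) ⟩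
  0ℚ + 1ℚ * f j                          ≡⟨ solve 1 (λ y → con 0ℚ :+ con 1ℚ :* y := y) refl (f j) ⟩
  f j                                    ∎
  where
  open ≡-Reasoning
  off : ∀ {i} → i ≢ j → δ i j * f i ≡ 0ℚ
  off {i} i≢j = trans (cong (_* f i) (δ-≢ i≢j)) (ℚ.*-zeroˡ (f i))
... | no j≢n = begin
  Σ< n (λ i → δ i j * f i) + δ n j * f n  ≡⟨ cong₂ _+_ (Σ<-δ n f (ℕ.≤∧≢⇒< (ℕ.≤-pred j<1+n) j≢n)) (cong (_* f n) (δ-≢ (j≢n ∘ sym))) ⟩
  f j + 0ℚ * f n                          ≡⟨ solve 2 (λ y z → y :+ con 0ℚ :* z := y) refl (f j) (f n) ⟩
  f j                                     ∎
  where open ≡-Reasoning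

ℕ→ℚ-^ : ∀ n p → ℕ→ℚ (n ^ p) ≡ ℕ→ℚ n ^ℚ p
ℕ→ℚ-^ n zero    = refl
ℕ→ℚ-^ n (suc p) = trans (ℕ→ℚ-* n (n ^ p)) (cong (ℕ→ℚ n *_) (ℕ→ℚ-^ n p))

1^n≡1 : ∀ n → 1ℚ ^ℚ n ≡ 1ℚ
1^n≡1 zero    = refl
1^n≡1 (suc n) = trans (ℚ.*-identityˡ _) (1^n≡1 n)

×ℚ≡ℕ→ℚ* : ∀ n x → n ×ℚ x ≡ ℕ→ℚ n * x
×ℚ≡ℕ→ℚ* zero    x = sym (ℚ.*-zeroˡ x)
×ℚ≡ℕ→ℚ* (suc n) x = begin
  x + n ×ℚ x            ≡⟨ cong (_+_ x) (×ℚ≡ℕ→ℚ* n x) ⟩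
  x + ℕ→ℚ n * x        ≡⟨ solve 2 (λ x y → x :+ y :* x := (y :+ con 1ℚ) :* x) refl x (ℕ→ℚ n) ⟩
  (ℕ→ℚ n + 1ℚ) * x     ≡⟨ cong (_* x) (ℕ→ℚ-suc n) ⟨
  ℕ→ℚ (suc n) * x      ∎
  where open ≡-Reasoning

sum≡Σ< : ∀ n (f : ℕ → ℚ) → ℚ-Sum.sum {n} (f ∘ Fin.toℕ) ≡ Σ< n f
sum≡Σ< zero    f = refl
sum≡Σ< (suc n) f = trans (cong (_+_ (f 0)) (sum≡Σ< n (f ∘ suc))) (sym (Σ<-front n f))

binomial : ∀ {m n} x → m < n → (x + 1ℚ) ^ℚ m ≡ Σ< n (λ i → ℕ→ℚ (m C i) * x ^ℚ i)
binomial {m} {n} x m<n = begin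
  (x + 1ℚ) ^ℚ m                                                       ≡⟨ Binomial.theorem m x 1ℚ ⟩
  ℚ-Sum.sum {suc m} (term ∘ Fin.toℕ)                                  ≡⟨ sum≡Σ< (suc m) term ⟩
  Σ< (suc m) term                                                     ≡⟨ Σ<-cong (suc m) (λ i _ → term≡ i) ⟩
  Σ< (suc m) (λ i → ℕ→ℚ (m C i) * x ^ℚ i)                              ≡⟨ Σ<-extend _ m<n vanish ⟨
  Σ< n (λ i → ℕ→ℚ (m C i) * x ^ℚ i)                                    ∎
  where
  open ≡-Reasoning
  term : ℕ → ℚ
  term i = (m C i) ×ℚ (x ^ℚ i * 1ℚ ^ℚ (m ∸ i))
  term≡ : ∀ i → term i ≡ ℕ→ℚ (m C i) * x ^ℚ i
  term≡ i = begin
    (m C i) ×ℚ (x ^ℚ i * 1ℚ ^ℚ (m ∸ i))        ≡⟨ ×ℚ≡ℕ→ℚ* (m C i) _ ⟩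
    ℕ→ℚ (m C i) * (x ^ℚ i * 1ℚ ^ℚ (m ∸ i))    ≡⟨ cong (λ y → ℕ→ℚ (m C i) * (x ^ℚ i * y)) (1^n≡1 (m ∸ i)) ⟩
    ℕ→ℚ (m C i) * (x ^ℚ i * 1ℚ)               ≡⟨ cong (ℕ→ℚ (m C i) *_) (ℚ.*-identityʳ _) ⟩
    ℕ→ℚ (m C i) * x ^ℚ i                       ∎
  vanish : ∀ i → suc m ≤ i → ℕ→ℚ (m C i) * x ^ℚ i ≡ 0ℚ
  vanish i m<i = trans (cong (λ k → ℕ→ℚ k * x ^ℚ i) (k>n⇒nCk≡0 m<i)) (ℚ.*-zeroˡ (x ^ℚ i))

C-factorial : ∀ m n → ((m ℕ.+ n) C m) ℕ.* (m ! ℕ.* n !) ≡ (m ℕ.+ n) !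
C-factorial m n = begin
  ((m ℕ.+ n) C m) ℕ.* (m ! ℕ.* n !)   ≡⟨ cong (λ k → ((m ℕ.+ n) C m) ℕ.* (m ! ℕ.* k !)) (ℕ.m+n∸m≡n m n) ⟨
  ((m ℕ.+ n) C m) ℕ.* d               ≡⟨ cong (ℕ._* d) (nCk≡n!/k![n-k]! m≤m+n) ⟩
  ((m ℕ.+ n) ! ℕ./ d) ℕ.* d           ≡⟨ m/n*n≡m (k![n∸k]!∣n! m≤m+n) ⟩
  (m ℕ.+ n) !                         ∎
  where
  open ≡-Reasoning
  m≤m+n = ℕ.m≤m+n m n
  d = m ! ℕ.* (m ℕ.+ n ∸ m) !
  instance _ = ℕ._!*_!≢0 m (m ℕ.+ n ∸ m)

-- Multiplied by i! j! k!, both sides become (i + j + k)!.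
C-trinomial : ∀ i {j r} → j ≤ r → ((i ℕ.+ r) C (i ℕ.+ j)) ℕ.* ((i ℕ.+ j) C i) ≡ ((i ℕ.+ r) C i) ℕ.* (r C j)
C-trinomial i {j} j≤r with ℕ.m≤n⇒∃[o]m+o≡n j≤r
... | k , refl = ℕ.*-cancelʳ-≡ _ _ (i ! ℕ.* (j ! ℕ.* k !)) {{ℕ.m*n≢0 (i !) _ {{ℕ._!≢0 i}} {{ℕ._!*_!≢0 j k}}}} (begin
  (N C (i ℕ.+ j)) ℕ.* ((i ℕ.+ j) C i) ℕ.* (i ! ℕ.* (j ! ℕ.* k !))
    ≡⟨ regroupˡ (N C (i ℕ.+ j)) ((i ℕ.+ j) C i) (i !) (j !) (k !) ⟩
  (N C (i ℕ.+ j)) ℕ.* (((i ℕ.+ j) C i) ℕ.* (i ! ℕ.* j !) ℕ.* k !)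
    ≡⟨ cong (λ a → (N C (i ℕ.+ j)) ℕ.* (a ℕ.* k !)) (C-factorial i j) ⟩
  (N C (i ℕ.+ j)) ℕ.* ((i ℕ.+ j) ! ℕ.* k !)
    ≡⟨ cong (λ n → (n C (i ℕ.+ j)) ℕ.* ((i ℕ.+ j) ! ℕ.* k !)) (ℕ.+-assoc i j k) ⟨
  ((i ℕ.+ j ℕ.+ k) C (i ℕ.+ j)) ℕ.* ((i ℕ.+ j) ! ℕ.* k !)
    ≡⟨ C-factorial (i ℕ.+ j) k ⟩
  (i ℕ.+ j ℕ.+ k) !
    ≡⟨ cong _! (ℕ.+-assoc i j k) ⟩
  N !
    ≡⟨ C-factorial i (j ℕ.+ k) ⟨
  (N C i) ℕ.* (i ! ℕ.* (j ℕ.+ k) !)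
    ≡⟨ cong (λ a → (N C i) ℕ.* (i ! ℕ.* a)) (C-factorial j k) ⟨
  (N C i) ℕ.* (i ! ℕ.* (((j ℕ.+ k) C j) ℕ.* (j ! ℕ.* k !)))
    ≡⟨ regroupʳ (N C i) ((j ℕ.+ k) C j) (i !) (j !) (k !) ⟩
  (N C i) ℕ.* ((j ℕ.+ k) C j) ℕ.* (i ! ℕ.* (j ! ℕ.* k !)) ∎)
  where
  open ≡-Reasoning
  N = i ℕ.+ (j ℕ.+ k)
  regroupˡ : ∀ a b x y z → a ℕ.* b ℕ.* (x ℕ.* (y ℕ.* z)) ≡ a ℕ.* (b ℕ.* (x ℕ.* y) ℕ.* z)
  regroupˡ = solve-∀
  regroupʳ : ∀ a b x y z → a ℕ.* (x ℕ.* (b ℕ.* (y ℕ.* z))) ≡ a ℕ.* b ℕ.* (x ℕ.* (y ℕ.* z))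
  regroupʳ = solve-∀

-- Bernoulli numbers and polynomials

lookup-∷ʳ-fromℕ : ∀ {n} (xs : Vec ℚ n) x → lookup (xs ∷ʳ x) (Fin.fromℕ n) ≡ x
lookup-∷ʳ-fromℕ []       x = refl
lookup-∷ʳ-fromℕ (y ∷ xs) x = lookup-∷ʳ-fromℕ xs x

lookup-∷ʳ-inject₁ : ∀ {n} (xs : Vec ℚ n) x i → lookup (xs ∷ʳ x) (Fin.inject₁ i) ≡ lookup xs i
lookup-∷ʳ-inject₁ (y ∷ xs) x Fin.zero    = refl
lookup-∷ʳ-inject₁ (y ∷ xs) x (Fin.suc i) = lookup-∷ʳ-inject₁ xs x i

lookup-bernoullis : ∀ n i → lookup (bernoullis n) i ≡ B (Fin.toℕ i)
lookup-bernoullis zero    Fin.zero = refl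
lookup-bernoullis (suc n) i with view i
... | ‵fromℕ     = cong B (sym (Fin.toℕ-fromℕ (suc n)))
... | ‵inject₁ j = begin
  lookup (bernoullis n ∷ʳ _) (Fin.inject₁ j)   ≡⟨ lookup-∷ʳ-inject₁ (bernoullis n) _ j ⟩
  lookup (bernoullis n) j                      ≡⟨ lookup-bernoullis n j ⟩
  B (Fin.toℕ j)                                ≡⟨ cong B (Fin.toℕ-inject₁ j) ⟨
  B (Fin.toℕ (Fin.inject₁ j))                  ∎
  where open ≡-Reasoning

foldr-+-tabulate : ∀ n (f : ℕ → ℚ) → Vec.foldr (λ _ → ℚ) _+_ 0ℚ (tabulate {n = n} (f ∘ Fin.toℕ)) ≡ Σ< n f
foldr-+-tabulate zero    f = refl
foldr-+-tabulate (suc n) f = trans (cong (_+_ (f 0)) (foldr-+-tabulate n (f ∘ suc))) (sym (Σ<-front n f))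

B-suc : ∀ n → B (suc n) ≡ - ((+ 1 / suc (suc n)) * Σ< (suc n) (λ k → ℕ→ℚ (suc (suc n) C k) * B k))
B-suc n = trans (lookup-∷ʳ-fromℕ (bernoullis n) _)
  (cong (λ s → - ((+ 1 / suc (suc n)) * s))
    (trans (cong (Vec.foldr (λ _ → ℚ) _+_ 0ℚ) (tabulate-cong (λ k → cong (ℕ→ℚ (suc (suc n) C Fin.toℕ k) *_) (lookup-bernoullis n k))))
           (foldr-+-tabulate (suc n) (λ k → ℕ→ℚ (suc (suc n) C k) * B k))))

bernoulli-sum : ∀ r → Σ< r (λ k → ℕ→ℚ (r C k) * B k) ≡ δ r 1
bernoulli-sum zero          = refl
bernoulli-sum (suc zero)    = refl
bernoulli-sum (suc (suc n)) = begin
  S + ℕ→ℚ (N C suc n) * B (suc n)       ≡⟨ cong₂ (λ c b → S + ℕ→ℚ c * b) N-C-N-1 (B-suc n) ⟩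
  S + ℕ→ℚ N * - (a * S)                 ≡⟨ solve 3 (λ s n a → s :+ n :* (:- (a :* s)) := s :+ (:- ((a :* n) :* s))) refl S (ℕ→ℚ N) a ⟩
  S + - ((a * ℕ→ℚ N) * S)               ≡⟨ cong (λ c → S + - (c * S)) (i/n*n≡i (+ 1) (suc n)) ⟩
  S + - (1ℚ * S)                        ≡⟨ solve 1 (λ s → s :+ (:- (con 1ℚ :* s)) := con 0ℚ) refl S ⟩
  0ℚ                                    ∎
  where
  open ≡-Reasoning
  N = suc (suc n)
  a = + 1 / N
  S = Σ< (suc n) (λ k → ℕ→ℚ (N C k) * B k)
  N-C-N-1 : N C suc n ≡ N
  N-C-N-1 = trans (nCk≡nC[n∸k] (ℕ.n≤1+n (suc n))) (trans (cong (N C_) (ℕ.m+n∸n≡m 1 (suc n))) (nC1≡n N))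

[1+n]C[n]≡1+n : ∀ n → suc n C n ≡ suc n
[1+n]C[n]≡1+n n = trans (nCk≡nC[n∸k] (ℕ.n≤1+n n)) (trans (cong (suc n C_) (ℕ.m+n∸n≡m 1 n)) (nC1≡n (suc n)))

bernoulliPoly : ℕ → ℚ → ℚ
bernoulliPoly N x = Σ< (suc N) (λ m → ℕ→ℚ (N C m) * B (N ∸ m) * x ^ℚ m)

bernoulli-sum-reversed : ∀ r → Σ< (suc r) (λ j → ℕ→ℚ (r C j) * B (r ∸ j)) ≡ B r + δ r 1
bernoulli-sum-reversed r = begin
  Σ< (suc r) (λ j → ℕ→ℚ (r C j) * B (r ∸ j))           ≡⟨ Σ<-cong (suc r) (λ j j≤r → cong (λ c → ℕ→ℚ c * B (r ∸ j)) (nCk≡nC[n∸k] (ℕ.≤-pred j≤r))) ⟩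
  Σ< (suc r) (λ j → ℕ→ℚ (r C (r ∸ j)) * B (r ∸ j))     ≡⟨ Σ<-reverse (suc r) (λ k → ℕ→ℚ (r C k) * B k) ⟩
  Σ< r (λ k → ℕ→ℚ (r C k) * B k) + ℕ→ℚ (r C r) * B r   ≡⟨ cong₂ (λ s c → s + ℕ→ℚ c * B r) (bernoulli-sum r) (nCn≡1 r) ⟩
  δ r 1 + 1ℚ * B r                                     ≡⟨ solve 2 (λ d b → d :+ con 1ℚ :* b := b :+ d) refl (δ r 1) (B r) ⟩
  B r + δ r 1                                          ∎
  where open ≡-Reasoning

bernoulli-convolution-+ : ∀ i r →
  Σ< (suc (i ℕ.+ r)) (λ m → ℕ→ℚ ((i ℕ.+ r) C m) * B ((i ℕ.+ r) ∸ m) * ℕ→ℚ (m C i)) ≡ ℕ→ℚ ((i ℕ.+ r) C i) * (B r + δ r 1)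
bernoulli-convolution-+ i r = begin
  Σ< (suc (i ℕ.+ r)) g                                   ≡⟨ cong (λ n → Σ< n g) (ℕ.+-suc i r) ⟨
  Σ< (i ℕ.+ suc r) g                                     ≡⟨ Σ<-split i (suc r) g ⟩
  Σ< i g + Σ< (suc r) (λ j → g (i ℕ.+ j))                ≡⟨ cong₂ _+_ (Σ<-zero i below) (Σ<-cong (suc r) (λ j j≤r → above j (ℕ.≤-pred j≤r))) ⟩
  0ℚ + Σ< (suc r) (λ j → Cᵢ * (ℕ→ℚ (r C j) * B (r ∸ j)))  ≡⟨ ℚ.+-identityˡ (Σ< (suc r) (λ j → Cᵢ * (ℕ→ℚ (r C j) * B (r ∸ j)))) ⟩
  Σ< (suc r) (λ j → Cᵢ * (ℕ→ℚ (r C j) * B (r ∸ j)))       ≡⟨ *-distribˡ-Σ< (suc r) Cᵢ _ ⟨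
  Cᵢ * Σ< (suc r) (λ j → ℕ→ℚ (r C j) * B (r ∸ j))         ≡⟨ cong (Cᵢ *_) (bernoulli-sum-reversed r) ⟩
  Cᵢ * (B r + δ r 1)                                     ∎
  where
  open ≡-Reasoning
  g : ℕ → ℚ
  g m = ℕ→ℚ ((i ℕ.+ r) C m) * B ((i ℕ.+ r) ∸ m) * ℕ→ℚ (m C i)
  Cᵢ = ℕ→ℚ ((i ℕ.+ r) C i)
  below : ∀ m → m < i → g m ≡ 0ℚ
  below m m<i = trans (cong (λ k → ℕ→ℚ ((i ℕ.+ r) C m) * B ((i ℕ.+ r) ∸ m) * ℕ→ℚ k) (k>n⇒nCk≡0 m<i)) (ℚ.*-zeroʳ (ℕ→ℚ ((i ℕ.+ r) C m) * B ((i ℕ.+ r) ∸ m)))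
  above : ∀ j → j ≤ r → g (i ℕ.+ j) ≡ Cᵢ * (ℕ→ℚ (r C j) * B (r ∸ j))
  above j j≤r = begin
    ℕ→ℚ X * B ((i ℕ.+ r) ∸ (i ℕ.+ j)) * ℕ→ℚ Y    ≡⟨ cong (λ k → ℕ→ℚ X * B k * ℕ→ℚ Y) (ℕ.[m+n]∸[m+o]≡n∸o i r j) ⟩
    ℕ→ℚ X * B (r ∸ j) * ℕ→ℚ Y                    ≡⟨ solve 3 (λ x b y → x :* b :* y := x :* y :* b) refl (ℕ→ℚ X) (B (r ∸ j)) (ℕ→ℚ Y) ⟩
    ℕ→ℚ X * ℕ→ℚ Y * B (r ∸ j)                    ≡⟨ cong (_* B (r ∸ j)) (ℕ→ℚ-* X Y) ⟨
    ℕ→ℚ (X ℕ.* Y) * B (r ∸ j)                    ≡⟨ cong (λ n → ℕ→ℚ n * B (r ∸ j)) (C-trinomial i j≤r) ⟩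
    ℕ→ℚ (((i ℕ.+ r) C i) ℕ.* (r C j)) * B (r ∸ j) ≡⟨ cong (_* B (r ∸ j)) (ℕ→ℚ-* ((i ℕ.+ r) C i) (r C j)) ⟩
    Cᵢ * ℕ→ℚ (r C j) * B (r ∸ j)                 ≡⟨ ℚ.*-assoc Cᵢ _ _ ⟩
    Cᵢ * (ℕ→ℚ (r C j) * B (r ∸ j))               ∎
    where
    X = (i ℕ.+ r) C (i ℕ.+ j)
    Y = (i ℕ.+ j) C i

bernoulli-convolution : ∀ {N i} → i ≤ N →
  Σ< (suc N) (λ m → ℕ→ℚ (N C m) * B (N ∸ m) * ℕ→ℚ (m C i)) ≡ ℕ→ℚ (N C i) * (B (N ∸ i) + δ (suc i) N)
bernoulli-convolution {N} {i} i≤N = begin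
  Σ< (suc N) (λ m → ℕ→ℚ (N C m) * B (N ∸ m) * ℕ→ℚ (m C i))
    ≡⟨ cong (λ n → Σ< (suc n) (λ m → ℕ→ℚ (n C m) * B (n ∸ m) * ℕ→ℚ (m C i))) i+r≡N ⟨
  Σ< (suc (i ℕ.+ r)) (λ m → ℕ→ℚ ((i ℕ.+ r) C m) * B ((i ℕ.+ r) ∸ m) * ℕ→ℚ (m C i))
    ≡⟨ bernoulli-convolution-+ i r ⟩
  ℕ→ℚ ((i ℕ.+ r) C i) * (B r + δ r 1)
    ≡⟨ cong₂ (λ n d → ℕ→ℚ (n C i) * (B r + d)) i+r≡N (δ-∸ N i) ⟩
  ℕ→ℚ (N C i) * (B r + δ (suc i) N)
    ∎
  where
  open ≡-Reasoning
  r = N ∸ i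
  i+r≡N = ℕ.m+[n∸m]≡n i≤N

bernoulliPoly-succ : ∀ p x → bernoulliPoly (suc p) (x + 1ℚ) ≡ bernoulliPoly (suc p) x + ℕ→ℚ (suc p) * x ^ℚ p
bernoulliPoly-succ p x = begin
  Σ< R (λ m → a m * (x + 1ℚ) ^ℚ m)
    ≡⟨ Σ<-cong R (λ m m<R → cong (a m *_) (binomial x m<R)) ⟩
  Σ< R (λ m → a m * Σ< R (λ i → ℕ→ℚ (m C i) * x ^ℚ i))
    ≡⟨ Σ<-cong R (λ m _ → trans (*-distribˡ-Σ< R (a m) _) (Σ<-cong R (λ i _ → sym (ℚ.*-assoc (a m) _ _)))) ⟩
  Σ< R (λ m → Σ< R (λ i → a m * ℕ→ℚ (m C i) * x ^ℚ i))
    ≡⟨ Σ<-comm R R _ ⟩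
  Σ< R (λ i → Σ< R (λ m → a m * ℕ→ℚ (m C i) * x ^ℚ i))
    ≡⟨ Σ<-cong R (λ i i<R → trans (sym (*-distribʳ-Σ< R (x ^ℚ i) _)) (cong (_* x ^ℚ i) (bernoulli-convolution (ℕ.≤-pred i<R)))) ⟩
  Σ< R (λ i → ℕ→ℚ (N C i) * (B (N ∸ i) + δ i p) * x ^ℚ i)
    ≡⟨ Σ<-cong R (λ i _ → regroup (ℕ→ℚ (N C i)) (B (N ∸ i)) (δ i p) (x ^ℚ i)) ⟩
  Σ< R (λ i → a i * x ^ℚ i + δ i p * (ℕ→ℚ (N C i) * x ^ℚ i))
    ≡⟨ Σ<-distrib-+ R _ _ ⟩
  bernoulliPoly N x + Σ< R (λ i → δ i p * (ℕ→ℚ (N C i) * x ^ℚ i))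
    ≡⟨ cong (_+_ (bernoulliPoly N x)) (Σ<-δ R (λ i → ℕ→ℚ (N C i) * x ^ℚ i) (ℕ.m<n⇒m<1+n (ℕ.n<1+n p))) ⟩
  bernoulliPoly N x + ℕ→ℚ (N C p) * x ^ℚ p
    ≡⟨ cong (λ k → bernoulliPoly N x + ℕ→ℚ k * x ^ℚ p) ([1+n]C[n]≡1+n p) ⟩
  bernoulliPoly N x + ℕ→ℚ N * x ^ℚ p
    ∎
  where
  open ≡-Reasoning
  N = suc p
  R = suc N
  a : ℕ → ℚ
  a m = ℕ→ℚ (N C m) * B (N ∸ m)
  regroup : ∀ c b d y → c * (b + d) * y ≡ c * b * y + d * (c * y)
  regroup = solve 4 (λ c b d y → c :* (b :+ d) :* y := c :* b :* y :+ d :* (c :* y)) refl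
-- The columns of M

-- Row m + 1, column p of M; the δ term compensates for B₁ = -1/2 on the superdiagonal p = m + 1.
bernoulliEntry : ℕ → ℕ → ℚ
bernoulliEntry m p = (+ 2 / suc p) * (ℕ→ℚ (suc p C suc m) * B (p ∸ m)) + δ (suc m) p

bernoulliEntry-diagonal : ∀ p → bernoulliEntry p p ≡ + 2 / suc p
bernoulliEntry-diagonal p = begin
  κ * (ℕ→ℚ (suc p C suc p) * B (p ∸ p)) + δ (suc p) p  ≡⟨ cong₂ (λ k d → κ * (ℕ→ℚ (suc p C suc p) * B k) + d) (ℕ.n∸n≡0 p) (δ-≢ (ℕ.1+n≢n {p})) ⟩
  κ * (ℕ→ℚ (suc p C suc p) * 1ℚ) + 0ℚ                  ≡⟨ cong (λ k → κ * (ℕ→ℚ k * 1ℚ) + 0ℚ) (nCn≡1 (suc p)) ⟩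
  κ * (1ℚ * 1ℚ) + 0ℚ                                    ≡⟨ solve 1 (λ c → c :* (con 1ℚ :* con 1ℚ) :+ con 0ℚ := c) refl κ ⟩
  κ                                                      ∎
  where
  open ≡-Reasoning
  κ = + 2 / suc p

bernoulliEntry-superdiagonal : ∀ m → bernoulliEntry m (suc m) ≡ 0ℚ
bernoulliEntry-superdiagonal m = begin
  κ * (ℕ→ℚ (suc (suc m) C suc m) * B (suc m ∸ m)) + δ (suc m) (suc m)
    ≡⟨ cong₂ (λ k d → κ * (ℕ→ℚ k * B (suc m ∸ m)) + d) ([1+n]C[n]≡1+n (suc m)) (δ-refl (suc m)) ⟩
  κ * (ℕ→ℚ (suc (suc m)) * B (suc m ∸ m)) + 1ℚ
    ≡⟨ cong (λ j → κ * (ℕ→ℚ (suc (suc m)) * B j) + 1ℚ) (ℕ.m+n∸n≡m 1 m) ⟩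
  κ * (ℕ→ℚ (suc (suc m)) * B 1) + 1ℚ
    ≡⟨ solve 3 (λ κ n b → κ :* (n :* b) :+ con 1ℚ := κ :* n :* b :+ con 1ℚ) refl κ (ℕ→ℚ (suc (suc m))) (B 1) ⟩
  κ * ℕ→ℚ (suc (suc m)) * B 1 + 1ℚ
    ≡⟨ cong (λ a → a * B 1 + 1ℚ) (i/n*n≡i (+ 2) (suc m)) ⟩
  + 2 / 1 * B 1 + 1ℚ
    ≡⟨⟩
  0ℚ
    ∎
  where
  open ≡-Reasoning
  κ = + 2 / suc (suc m)

bernoulliEntry-below : ∀ {m p} → p < m → bernoulliEntry m p ≡ 0ℚ
bernoulliEntry-below {m} {p} p<m = begin
  κ * (ℕ→ℚ (suc p C suc m) * B (p ∸ m)) + δ (suc m) p  ≡⟨ cong₂ (λ k d → κ * (ℕ→ℚ k * B (p ∸ m)) + d) (k>n⇒nCk≡0 (s≤s p<m)) (δ-≢ (ℕ.<⇒≢ (ℕ.m<n⇒m<1+n p<m) ∘ sym)) ⟩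
  κ * (0ℚ * B (p ∸ m)) + 0ℚ                             ≡⟨ solve 2 (λ κ b → κ :* (con 0ℚ :* b) :+ con 0ℚ := con 0ℚ) refl κ (B (p ∸ m)) ⟩
  0ℚ                                                    ∎
  where
  open ≡-Reasoning
  κ = + 2 / suc p

M-suc : ∀ e m p → M e (suc m) p ≡ bernoulliEntry m p
M-suc e m p with p ℕ.≟ m
... | yes refl = sym (bernoulliEntry-diagonal p)
... | no p≢m with suc (suc m) ≤? p
...   | yes 1+m<p = begin
  κ * B (p ∸ m) * ℕ→ℚ (suc p C (p ∸ m))                ≡⟨ cong (λ k → κ * B (p ∸ m) * ℕ→ℚ k) (nCk≡nC[n∸k] (ℕ.m≤n⇒m≤1+n (ℕ.<⇒≤ 1+m<p))) ⟨
  κ * B (p ∸ m) * ℕ→ℚ (suc p C suc m)                  ≡⟨ solve 3 (λ κ b k → κ :* b :* k := κ :* (k :* b) :+ con 0ℚ) refl κ (B (p ∸ m)) (ℕ→ℚ (suc p C suc m)) ⟩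
  κ * (ℕ→ℚ (suc p C suc m) * B (p ∸ m)) + 0ℚ           ≡⟨ cong (_+_ (κ * (ℕ→ℚ (suc p C suc m) * B (p ∸ m)))) (δ-≢ (ℕ.<⇒≢ 1+m<p)) ⟨
  bernoulliEntry m p                                    ∎
  where
  open ≡-Reasoning
  κ = + 2 / suc p
...   | no 1+m≮p with p ℕ.≟ suc m
...     | yes refl = sym (bernoulliEntry-superdiagonal m)
...     | no p≢1+m = sym (bernoulliEntry-below (ℕ.≤∧≢⇒< (ℕ.≤-pred (ℕ.≤∧≢⇒< (ℕ.≤-pred (ℕ.≰⇒> 1+m≮p)) p≢1+m)) p≢m))

M-below : ∀ e {m p} → suc p < m → M e m p ≡ 0ℚ
M-below e {suc m} {p} (s≤s p<m) = trans (M-suc e m p) (bernoulliEntry-below p<m)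

columnPoly : ℕ → ℕ → ℚ → ℚ
columnPoly e p x = Σ< (suc (suc p)) (λ m → M e m p * x ^ℚ m)

columnPoly-rows : ∀ e {p R} x → suc (suc p) ≤ R → Σ< R (λ m → M e m p * x ^ℚ m) ≡ columnPoly e p x
columnPoly-rows e x 2+p≤R = Σ<-extend _ 2+p≤R (λ m 2+p≤m → trans (cong (_* x ^ℚ m) (M-below e 2+p≤m)) (ℚ.*-zeroˡ (x ^ℚ m)))

bernoulliPoly-front : ∀ p x →
  bernoulliPoly (suc p) x ≡ B (suc p) + Σ< (suc p) (λ m → ℕ→ℚ (suc p C suc m) * B (p ∸ m) * x ^ℚ suc m)
bernoulliPoly-front p x = trans (Σ<-front (suc p) _)
  (cong (_+ Σ< (suc p) (λ m → ℕ→ℚ (suc p C suc m) * B (p ∸ m) * x ^ℚ suc m))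
    (solve 1 (λ b → con 1ℚ :* b :* con 1ℚ := b) refl (B (suc p))))

columnPoly-bernoulli : ∀ e p x → columnPoly e p x ≡ x ^ℚ p + (+ 2 / suc p) * (bernoulliPoly (suc p) x - B (suc p))
columnPoly-bernoulli e p x = begin
  columnPoly e p x
    ≡⟨ Σ<-front (suc p) _ ⟩
  M e 0 p * 1ℚ + Σ< (suc p) (λ m → M e (suc m) p * x ^ℚ suc m)
    ≡⟨ cong (_+_ (M e 0 p * 1ℚ)) (Σ<-cong (suc p) (λ m _ → trans (cong (_* x ^ℚ suc m) (M-suc e m p)) (split m))) ⟩
  M e 0 p * 1ℚ + Σ< (suc p) (λ m → κ * b m + d m)
    ≡⟨ cong (_+_ (M e 0 p * 1ℚ)) (trans (Σ<-distrib-+ (suc p) _ d) (cong (_+ Σ< (suc p) d) (sym (*-distribˡ-Σ< (suc p) κ b)))) ⟩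
  M e 0 p * 1ℚ + (κ * Σ< (suc p) b + Σ< (suc p) d)
    ≡⟨ solve 5 (λ a κ s t c → a :+ (κ :* s :+ t) := (a :+ t) :+ κ :* ((c :+ s) :- c)) refl (M e 0 p * 1ℚ) κ (Σ< (suc p) b) (Σ< (suc p) d) (B (suc p)) ⟩
  (M e 0 p * 1ℚ + Σ< (suc p) d) + κ * ((B (suc p) + Σ< (suc p) b) - B (suc p))
    ≡⟨ cong₂ (λ a t → a + κ * (t - B (suc p))) (power p) (sym (bernoulliPoly-front p x)) ⟩
  x ^ℚ p + κ * (bernoulliPoly (suc p) x - B (suc p))
    ∎
  where
  open ≡-Reasoning
  κ = + 2 / suc p
  b d : ℕ → ℚ
  b m = ℕ→ℚ (suc p C suc m) * B (p ∸ m) * x ^ℚ suc m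
  d m = δ (suc m) p * x ^ℚ suc m
  split : ∀ m → bernoulliEntry m p * x ^ℚ suc m ≡ κ * b m + d m
  split m = solve 5 (λ κ c b d y → (κ :* (c :* b) :+ d) :* y := κ :* (c :* b :* y) :+ d :* y) refl
    κ (ℕ→ℚ (suc p C suc m)) (B (p ∸ m)) (δ (suc m) p) (x ^ℚ suc m)
  power : ∀ p → M e 0 p * 1ℚ + Σ< (suc p) (λ m → δ (suc m) p * x ^ℚ suc m) ≡ x ^ℚ p
  power zero    = solve 1 (λ x → con 1ℚ :* con 1ℚ :+ (con 0ℚ :+ con 0ℚ :* (x :* con 1ℚ)) := con 1ℚ) refl x
  power (suc q) = trans (cong (_+_ (0ℚ * 1ℚ)) (Σ<-δ (suc (suc q)) (λ m → x ^ℚ suc m) (ℕ.m<n⇒m<1+n (ℕ.n<1+n q)))) (ℚ.+-identityˡ _)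

columnPoly-succ : ∀ e p x → columnPoly e p (x + 1ℚ) ≡ columnPoly e p x + ((x + 1ℚ) ^ℚ p + x ^ℚ p)
columnPoly-succ e p x = begin
  columnPoly e p (x + 1ℚ)
    ≡⟨ columnPoly-bernoulli e p (x + 1ℚ) ⟩
  y + κ * (bernoulliPoly (suc p) (x + 1ℚ) - b)
    ≡⟨ cong (λ t → y + κ * (t - b)) (bernoulliPoly-succ p x) ⟩
  y + κ * ((t + n * z) - b)
    ≡⟨ solve 6 (λ y κ t n z b → y :+ κ :* ((t :+ n :* z) :- b) := y :+ κ :* (t :- b) :+ κ :* n :* z) refl y κ t n z b ⟩
  y + κ * (t - b) + κ * n * z
    ≡⟨ cong (λ a → y + κ * (t - b) + a * z) (i/n*n≡i (+ 2) p) ⟩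
  y + κ * (t - b) + + 2 / 1 * z
    ≡⟨ solve 5 (λ y κ t b z → y :+ κ :* (t :- b) :+ con (+ 2 / 1) :* z := (z :+ κ :* (t :- b)) :+ (y :+ z)) refl y κ t b z ⟩
  (z + κ * (t - b)) + (y + z)
    ≡⟨ cong (_+ (y + z)) (columnPoly-bernoulli e p x) ⟨
  columnPoly e p x + (y + z)
    ∎
  where
  open ≡-Reasoning
  κ = + 2 / suc p
  y = (x + 1ℚ) ^ℚ p
  z = x ^ℚ p
  t = bernoulliPoly (suc p) x
  b = B (suc p)
  n = ℕ→ℚ (suc p)

columnPoly-zero : ∀ e p → columnPoly e p 0ℚ ≡ 0ℚ ^ℚ p
columnPoly-zero e p = begin
  columnPoly e p 0ℚ                                                    ≡⟨ Σ<-front (suc p) _ ⟩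
  M e 0 p * 1ℚ + Σ< (suc p) (λ m → M e (suc m) p * (0ℚ * 0ℚ ^ℚ m))     ≡⟨ cong (_+_ (M e 0 p * 1ℚ)) (Σ<-zero (suc p) (λ m _ → solve 2 (λ a z → a :* (con 0ℚ :* z) := con 0ℚ) refl (M e (suc m) p) (0ℚ ^ℚ m))) ⟩
  M e 0 p * 1ℚ + 0ℚ                                                    ≡⟨ corner p ⟩
  0ℚ ^ℚ p                                                              ∎
  where
  open ≡-Reasoning
  corner : ∀ p → M e 0 p * 1ℚ + 0ℚ ≡ 0ℚ ^ℚ p
  corner zero    = refl
  corner (suc p) = sym (ℚ.*-zeroˡ (0ℚ ^ℚ p))

columnPoly-faulhaber : ∀ e p n → columnPoly e p (ℕ→ℚ n) ≡ ℕ→ℚ n ^ℚ p + ℕ→ℚ 2 * Σ< n (λ i → ℕ→ℚ i ^ℚ p)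
columnPoly-faulhaber e p zero    = trans (columnPoly-zero e p) (sym (trans (cong (_+_ (0ℚ ^ℚ p)) (ℚ.*-zeroʳ (ℕ→ℚ 2))) (ℚ.+-identityʳ _)))
columnPoly-faulhaber e p (suc n) = begin
  columnPoly e p (ℕ→ℚ (suc n))
    ≡⟨ cong (columnPoly e p) (ℕ→ℚ-suc n) ⟩
  columnPoly e p (x + 1ℚ)
    ≡⟨ columnPoly-succ e p x ⟩
  columnPoly e p x + ((x + 1ℚ) ^ℚ p + x ^ℚ p)
    ≡⟨ cong (_+ ((x + 1ℚ) ^ℚ p + x ^ℚ p)) (columnPoly-faulhaber e p n) ⟩
  (x ^ℚ p + ℕ→ℚ 2 * S) + ((x + 1ℚ) ^ℚ p + x ^ℚ p)
    ≡⟨ solve 3 (λ z S y → (z :+ con (ℕ→ℚ 2) :* S) :+ (y :+ z) := y :+ con (ℕ→ℚ 2) :* (S :+ z)) refl (x ^ℚ p) S ((x + 1ℚ) ^ℚ p) ⟩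
  (x + 1ℚ) ^ℚ p + ℕ→ℚ 2 * (S + x ^ℚ p)
    ≡⟨ cong (λ u → u ^ℚ p + ℕ→ℚ 2 * (S + x ^ℚ p)) (ℕ→ℚ-suc n) ⟨
  ℕ→ℚ (suc n) ^ℚ p + ℕ→ℚ 2 * Σ< (suc n) (λ i → ℕ→ℚ i ^ℚ p)
    ∎
  where
  open ≡-Reasoning
  x = ℕ→ℚ n
  S = Σ< n (λ i → ℕ→ℚ i ^ℚ p)

-- cardinalityPoly k n = c_{k+1} · n_{k+1}, indexed like c'.
cardinalityPoly : ℕ → ℕ → ℚ
cardinalityPoly k n = Σ< (suc (suc k)) (λ p → c' k p * ℕ→ℚ n ^ℚ p)

cardinalityPoly-suc : ∀ k n → cardinalityPoly (suc k) n ≡ cardinalityPoly k n + ℕ→ℚ 2 * Σ< n (cardinalityPoly k)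
cardinalityPoly-suc k n = begin
  Σ< R (λ m → c' (suc k) m * x ^ℚ m)
    ≡⟨ Σ<-cong R (λ m _ → trans (cong (_* x ^ℚ m) (sumTo≡Σ< (suc k) _)) (*-distribʳ-Σ< P (x ^ℚ m) _)) ⟩
  Σ< R (λ m → Σ< P (λ p → M (suc k) m p * c' k p * x ^ℚ m))
    ≡⟨ Σ<-comm R P _ ⟩
  Σ< P (λ p → Σ< R (λ m → M (suc k) m p * c' k p * x ^ℚ m))
    ≡⟨ Σ<-cong P column ⟩
  Σ< P (λ p → c' k p * x ^ℚ p + ℕ→ℚ 2 * Σ< n (λ i → c' k p * ℕ→ℚ i ^ℚ p))
    ≡⟨ Σ<-distrib-+ P _ _ ⟩
  cardinalityPoly k n + Σ< P (λ p → ℕ→ℚ 2 * Σ< n (λ i → c' k p * ℕ→ℚ i ^ℚ p))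
    ≡⟨ cong (_+_ (cardinalityPoly k n)) (trans (sym (*-distribˡ-Σ< P (ℕ→ℚ 2) _)) (cong (ℕ→ℚ 2 *_) (Σ<-comm P n _))) ⟩
  cardinalityPoly k n + ℕ→ℚ 2 * Σ< n (cardinalityPoly k)
    ∎
  where
  open ≡-Reasoning
  P = suc (suc k)
  R = suc P
  x = ℕ→ℚ n
  column : ∀ p → p < P →
    Σ< R (λ m → M (suc k) m p * c' k p * x ^ℚ m) ≡ c' k p * x ^ℚ p + ℕ→ℚ 2 * Σ< n (λ i → c' k p * ℕ→ℚ i ^ℚ p)
  column p p<P = begin
    Σ< R (λ m → M (suc k) m p * c' k p * x ^ℚ m)
      ≡⟨ Σ<-cong R (λ m _ → solve 3 (λ a c y → a :* c :* y := c :* (a :* y)) refl (M (suc k) m p) (c' k p) (x ^ℚ m)) ⟩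
    Σ< R (λ m → c' k p * (M (suc k) m p * x ^ℚ m))
      ≡⟨ *-distribˡ-Σ< R (c' k p) _ ⟨
    c' k p * Σ< R (λ m → M (suc k) m p * x ^ℚ m)
      ≡⟨ cong (c' k p *_) (columnPoly-rows (suc k) x (s≤s p<P)) ⟩
    c' k p * columnPoly (suc k) p x
      ≡⟨ cong (c' k p *_) (columnPoly-faulhaber (suc k) p n) ⟩
    c' k p * (x ^ℚ p + ℕ→ℚ 2 * Σ< n (λ i → ℕ→ℚ i ^ℚ p))
      ≡⟨ solve 4 (λ c y t S → c :* (y :+ t :* S) := c :* y :+ t :* (c :* S)) refl (c' k p) (x ^ℚ p) (ℕ→ℚ 2) _ ⟩
    c' k p * x ^ℚ p + ℕ→ℚ 2 * (c' k p * Σ< n (λ i → ℕ→ℚ i ^ℚ p))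
      ≡⟨ cong (λ s → c' k p * x ^ℚ p + ℕ→ℚ 2 * s) (*-distribˡ-Σ< n (c' k p) _) ⟩
    c' k p * x ^ℚ p + ℕ→ℚ 2 * Σ< n (λ i → c' k p * ℕ→ℚ i ^ℚ p)
      ∎

-- Walks and the ℓ¹ norm

infixl 6 _⊕_
_⊕_ : ∀ {d} → Vecℤ d → Vecℤ d → Vecℤ d
_⊕_ = zipWith ℤ._+_

sign : Bool → ℤ
sign b = if b then + 1 else -[1+ 0 ]

zeros : ∀ d → Vecℤ d
zeros d = tabulate (λ _ → + 0)

zeros-⊕ : ∀ {d} (x : Vecℤ d) → zeros d ⊕ x ≡ x
zeros-⊕ []      = refl
zeros-⊕ (t ∷ x) = cong₂ _∷_ (ℤ.+-identityˡ t) (zeros-⊕ x)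

stepVec-zero-⊕ : ∀ {d} b t (y : Vecℤ d) → stepVec (Fin.zero , b) ⊕ (t ∷ y) ≡ (sign b ℤ.+ t) ∷ y
stepVec-zero-⊕ b t y = cong (sign b ℤ.+ t ∷_) (zeros-⊕ y)

InP-step₀ : ∀ {d n} b {t} {y : Vecℤ d} → InP (suc d) n (t ∷ y) → InP (suc d) (suc n) ((sign b ℤ.+ t) ∷ y)
InP-step₀ b {t} {y} (ss , ss↦ty) = (Fin.zero , b) ∷ ss , trans (cong (stepVec (Fin.zero , b) ⊕_) ss↦ty) (stepVec-zero-⊕ b t y)

InP-lift : ∀ {d n} {y : Vecℤ d} → InP d n y → InP (suc d) n (+ 0 ∷ y)
InP-lift (ss , refl) = Vec.map (λ (i , b) → Fin.suc i , b) ss , endpoint-lift ss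
  where
  endpoint-lift : ∀ {d n} (ss : Vec (Step d) n) → endpoint (Vec.map (λ (i , b) → Fin.suc i , b) ss) ≡ + 0 ∷ endpoint ss
  endpoint-lift []            = refl
  endpoint-lift ((i , b) ∷ ss) = cong (stepVec (Fin.suc i , b) ⊕_) (endpoint-lift ss)

InP-+2 : ∀ {d n} {x : Vecℤ (suc d)} → InP (suc d) n x → InP (suc d) (suc (suc n)) x
InP-+2 (ss , refl) = (Fin.zero , true) ∷ (Fin.zero , false) ∷ ss , back-and-forth (endpoint ss)
  where
  back-and-forth : ∀ {d} (x : Vecℤ (suc d)) → stepVec (Fin.zero , true) ⊕ (stepVec (Fin.zero , false) ⊕ x) ≡ x
  back-and-forth (t ∷ y) = begin
    stepVec (Fin.zero , true) ⊕ (stepVec (Fin.zero , false) ⊕ (t ∷ y))  ≡⟨ cong (stepVec (Fin.zero , true) ⊕_) (stepVec-zero-⊕ false t y) ⟩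
    stepVec (Fin.zero , true) ⊕ ((-[1+ 0 ] ℤ.+ t) ∷ y)                  ≡⟨ stepVec-zero-⊕ true (-[1+ 0 ] ℤ.+ t) y ⟩
    (+ 1 ℤ.+ (-[1+ 0 ] ℤ.+ t)) ∷ y                                       ≡⟨ cong (_∷ y) (trans (sym (ℤ.+-assoc (+ 1) -[1+ 0 ] t)) (ℤ.+-identityˡ t)) ⟩
    t ∷ y                                                                ∎
    where open ≡-Reasoning

∥_∥₁ : ∀ {d} → Vecℤ d → ℕ
∥ []    ∥₁ = 0
∥ t ∷ x ∥₁ = ℤ.∣ t ∣ ℕ.+ ∥ x ∥₁

Reachable : ∀ {d} → ℕ → Vecℤ d → Set
Reachable n x = ∃[ k ] ∥ x ∥₁ ℕ.+ 2 ℕ.* k ≡ n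

∥replicate-0∥₁ : ∀ d → ∥ replicate d (+ 0) ∥₁ ≡ 0
∥replicate-0∥₁ zero    = refl
∥replicate-0∥₁ (suc d) = ∥replicate-0∥₁ d

∣sign+t∣ : ∀ b t → ℤ.∣ sign b ℤ.+ t ∣ ≡ suc ℤ.∣ t ∣ ⊎ suc ℤ.∣ sign b ℤ.+ t ∣ ≡ ℤ.∣ t ∣
∣sign+t∣ true  (+ m)         = inj₁ refl
∣sign+t∣ true  -[1+ zero ]   = inj₂ refl
∣sign+t∣ true  -[1+ suc m ]  = inj₂ refl
∣sign+t∣ false (+ zero)      = inj₁ refl
∣sign+t∣ false (+ suc m)     = inj₂ refl
∣sign+t∣ false -[1+ m ]      = inj₁ refl

∥step⊕x∥₁ : ∀ {d} (s : Step d) x → ∥ stepVec s ⊕ x ∥₁ ≡ suc ∥ x ∥₁ ⊎ suc ∥ stepVec s ⊕ x ∥₁ ≡ ∥ x ∥₁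
∥step⊕x∥₁ (Fin.zero , b) (t ∷ y) rewrite zeros-⊕ y with ∣sign+t∣ b t
... | inj₁ e = inj₁ (cong (ℕ._+ ∥ y ∥₁) e)
... | inj₂ e = inj₂ (cong (ℕ._+ ∥ y ∥₁) e)
∥step⊕x∥₁ (Fin.suc i , b) (t ∷ y) rewrite ℤ.+-identityˡ t with ∥step⊕x∥₁ (i , b) y
... | inj₁ e = inj₁ (trans (cong (ℤ.∣ t ∣ ℕ.+_) e) (ℕ.+-suc ℤ.∣ t ∣ ∥ y ∥₁))
... | inj₂ e = inj₂ (trans (sym (ℕ.+-suc ℤ.∣ t ∣ _)) (cong (ℤ.∣ t ∣ ℕ.+_) e))

+-2*suc : ∀ a k → a ℕ.+ 2 ℕ.* suc k ≡ suc (suc (a ℕ.+ 2 ℕ.* k))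
+-2*suc = solve-∀

endpoint-reachable : ∀ {d n} (ss : Vec (Step d) n) → Reachable n (endpoint ss)
endpoint-reachable {d} [] = 0 , trans (ℕ.+-identityʳ _) (∥replicate-0∥₁ d)
endpoint-reachable (s ∷ ss) with endpoint-reachable ss | ∥step⊕x∥₁ s (endpoint ss)
... | k , eq | inj₁ e = k , trans (cong (ℕ._+ 2 ℕ.* k) e) (cong suc eq)
... | k , eq | inj₂ e = suc k , trans (+-2*suc _ k) (cong suc (trans (cong (ℕ._+ 2 ℕ.* k) e) eq))

walk-straight : ∀ {d} (x : Vecℤ d) → InP d ∥ x ∥₁ x
walk-straight []                  = [] , refl
walk-straight (+ zero ∷ y)        = InP-lift (walk-straight y)
walk-straight (+ suc m ∷ y)       = InP-step₀ true (walk-straight (+ m ∷ y))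
walk-straight (-[1+ zero ] ∷ y)   = InP-step₀ false (InP-lift (walk-straight y))
walk-straight (-[1+ suc m ] ∷ y)  = InP-step₀ false (walk-straight (-[1+ m ] ∷ y))

InP⇔Reachable : ∀ {d n} (x : Vecℤ (suc d)) → InP (suc d) n x ⇔ Reachable n x
InP⇔Reachable {d} x = mk⇔ (λ (ss , ss↦x) → subst (Reachable _) ss↦x (endpoint-reachable ss)) (λ (k , eq) → subst (λ n → InP (suc d) n x) eq (padded k))
  where
  padded : ∀ k → InP (suc d) (∥ x ∥₁ ℕ.+ 2 ℕ.* k) x
  padded zero    = subst (λ n → InP (suc d) n x) (sym (ℕ.+-identityʳ _)) (walk-straight x)
  padded (suc k) = subst (λ n → InP (suc d) n x) (sym (+-2*suc _ k)) (InP-+2 (padded k))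

Reachable-∷ : ∀ {d r} t (y : Vecℤ d) → Reachable r y → Reachable (ℤ.∣ t ∣ ℕ.+ r) (t ∷ y)
Reachable-∷ t y (k , eq) = k , trans (ℕ.+-assoc ℤ.∣ t ∣ _ _) (cong (ℤ.∣ t ∣ ℕ.+_) eq)

Reachable-∷⁻ : ∀ {d r} t (y : Vecℤ d) → Reachable (ℤ.∣ t ∣ ℕ.+ r) (t ∷ y) → Reachable r y
Reachable-∷⁻ t y (k , eq) = k , ℕ.+-cancelˡ-≡ ℤ.∣ t ∣ _ _ (trans (sym (ℕ.+-assoc ℤ.∣ t ∣ _ _)) eq)

Reachable-+-suc : ∀ {d} a r (x : Vecℤ d) → Reachable (a ℕ.+ suc r) x → Reachable (suc a ℕ.+ r) x
Reachable-+-suc a r x = subst (λ n → Reachable n x) (ℕ.+-suc a r)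

Reachable-suc-+ : ∀ {d} a r (x : Vecℤ d) → Reachable (suc a ℕ.+ r) x → Reachable (a ℕ.+ suc r) x
Reachable-suc-+ a r x = subst (λ n → Reachable n x) (sym (ℕ.+-suc a r))

-- Enumerating the reachable points

evens : ℕ → List (Vecℤ 0)
evens zero          = [] ∷ []
evens (suc zero)    = []
evens (suc (suc n)) = evens n

mutual
  points : (d n : ℕ) → List (Vecℤ d)
  points zero    n = evens n
  points (suc d) n = map (+ 0 ∷_) (points d n) ++ shell d n 0

  -- shell d r a: the points reachable in a + r steps whose first coordinate exceeds a in absolute value
  shell : (d r a : ℕ) → List (Vecℤ (suc d))
  shell d zero    a = []
  shell d (suc r) a = map (+ suc a ∷_) (points d r) ++ map (-[1+ a ] ∷_) (points d r) ++ shell d r (suc a)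

[]∈evens⇔ : ∀ n → [] ∈ evens n ⇔ Reachable n []
[]∈evens⇔ n = mk⇔ (to n) (λ (k , eq) → subst (λ n → [] ∈ evens n) eq (even k))
  where
  to : ∀ n → [] ∈ evens n → Reachable n []
  to zero          _  = 0 , refl
  to (suc (suc n)) []∈ with to n []∈
  ... | k , eq = suc k , trans (+-2*suc 0 k) (cong (suc ∘ suc) eq)
  even : ∀ k → [] ∈ evens (2 ℕ.* k)
  even zero    = here refl
  even (suc k) = subst (λ n → [] ∈ evens n) (sym (+-2*suc 0 k)) (even k)

∈-map-∷⁻ : ∀ {d c t} {y : Vecℤ d} {ys} → (t ∷ y) ∈ map (c ∷_) ys → t ≡ c × y ∈ ys
∈-map-∷⁻ {c = c} t∷y∈ with ∈-map⁻ (c ∷_) t∷y∈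
... | y′ , y′∈ , eq with ∷-injective eq
...   | refl , refl = refl , y′∈

mutual
  ∈points⇒Reachable : ∀ d {n} x → x ∈ points d n → Reachable n x
  ∈points⇒Reachable zero    []      x∈ = Equivalence.to ([]∈evens⇔ _) x∈
  ∈points⇒Reachable (suc d) {n} (t ∷ y) x∈ with ∈-++⁻ (map (+ 0 ∷_) (points d n)) x∈
  ... | inj₁ x∈₀ with ∈-map-∷⁻ x∈₀
  ...   | refl , y∈ = Reachable-∷ (+ 0) y (∈points⇒Reachable d y y∈)
  ∈points⇒Reachable (suc d) {n} (t ∷ y) x∈ | inj₂ x∈shell = proj₂ (∈shell⇒ d n 0 t y x∈shell)

  ∈shell⇒ : ∀ d r a t (y : Vecℤ d) → (t ∷ y) ∈ shell d r a → a < ℤ.∣ t ∣ × Reachable (a ℕ.+ r) (t ∷ y)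
  ∈shell⇒ d (suc r) a t y x∈ with ∈-++⁻ (map (+ suc a ∷_) (points d r)) x∈
  ... | inj₁ x∈₊ with ∈-map-∷⁻ x∈₊
  ...   | refl , y∈ = ℕ.≤-refl , Reachable-suc-+ a r (t ∷ y) (Reachable-∷ t y (∈points⇒Reachable d y y∈))
  ∈shell⇒ d (suc r) a t y x∈ | inj₂ x∈′ with ∈-++⁻ (map (-[1+ a ] ∷_) (points d r)) x∈′
  ... | inj₁ x∈₋ with ∈-map-∷⁻ x∈₋
  ...   | refl , y∈ = ℕ.≤-refl , Reachable-suc-+ a r (t ∷ y) (Reachable-∷ t y (∈points⇒Reachable d y y∈))
  ∈shell⇒ d (suc r) a t y x∈ | inj₂ x∈′ | inj₂ x∈deeper with ∈shell⇒ d r (suc a) t y x∈deeper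
  ... | 1+a<∣t∣ , R = ℕ.<⇒≤ 1+a<∣t∣ , Reachable-suc-+ a r (t ∷ y) R

mutual
  Reachable⇒∈points : ∀ d {n} x → Reachable n x → x ∈ points d n
  Reachable⇒∈points zero          []            R = Equivalence.from ([]∈evens⇔ _) R
  Reachable⇒∈points (suc d)       (+ zero ∷ y)  R =
    ∈-++⁺ˡ (∈-map⁺ (+ 0 ∷_) (Reachable⇒∈points d y (Reachable-∷⁻ (+ 0) y R)))
  Reachable⇒∈points (suc d) {n}   (+ suc m ∷ y) R =
    ∈-++⁺ʳ (map (+ 0 ∷_) (points d n)) (Reachable⇒∈shell d n 0 (+ suc m) y (s≤s z≤n) R)
  Reachable⇒∈points (suc d) {n}   (-[1+ m ] ∷ y) R =
    ∈-++⁺ʳ (map (+ 0 ∷_) (points d n)) (Reachable⇒∈shell d n 0 -[1+ m ] y (s≤s z≤n) R)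

  Reachable⇒∈shell : ∀ d r a t (y : Vecℤ d) → a < ℤ.∣ t ∣ → Reachable (a ℕ.+ r) (t ∷ y) → (t ∷ y) ∈ shell d r a
  Reachable⇒∈shell d zero a t y a<∣t∣ (k , eq) = ⊥-elim (ℕ.<⇒≱ a<∣t∣ ∣t∣≤a)
    where
    ∣t∣≤a : ℤ.∣ t ∣ ≤ a
    ∣t∣≤a = ℕ.m+n≤o⇒m≤o _ (ℕ.m+n≤o⇒m≤o _ (ℕ.≤-reflexive (trans eq (ℕ.+-identityʳ a))))
  Reachable⇒∈shell d (suc r) a (+ n) y a<n R with ℕ.m≤n⇒m<n∨m≡n a<n
  ... | inj₁ 1+a<n = ∈-++⁺ʳ (map (+ suc a ∷_) (points d r)) (∈-++⁺ʳ (map (-[1+ a ] ∷_) (points d r))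
                       (Reachable⇒∈shell d r (suc a) (+ n) y 1+a<n (Reachable-+-suc a r (+ n ∷ y) R)))
  ... | inj₂ refl  = ∈-++⁺ˡ (∈-map⁺ (+ suc a ∷_)
                       (Reachable⇒∈points d y (Reachable-∷⁻ (+ suc a) y (Reachable-+-suc a r (+ n ∷ y) R))))
  Reachable⇒∈shell d (suc r) a -[1+ n ] y a<1+n R with ℕ.m≤n⇒m<n∨m≡n a<1+n
  ... | inj₁ 1+a<1+n = ∈-++⁺ʳ (map (+ suc a ∷_) (points d r)) (∈-++⁺ʳ (map (-[1+ a ] ∷_) (points d r))
                         (Reachable⇒∈shell d r (suc a) -[1+ n ] y 1+a<1+n (Reachable-+-suc a r (-[1+ n ] ∷ y) R)))
  ... | inj₂ refl    = ∈-++⁺ʳ (map (+ suc a ∷_) (points d r)) (∈-++⁺ˡ (∈-map⁺ (-[1+ a ] ∷_)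
                         (Reachable⇒∈points d y (Reachable-∷⁻ -[1+ a ] y (Reachable-+-suc a r (-[1+ n ] ∷ y) R)))))

∈points⇔Reachable : ∀ d {n} x → x ∈ points d n ⇔ Reachable n x
∈points⇔Reachable d x = mk⇔ (∈points⇒Reachable d x) (Reachable⇒∈points d x)

evens-unique : ∀ n → Unique (evens n)
evens-unique zero          = [] ∷ []
evens-unique (suc zero)    = []
evens-unique (suc (suc n)) = evens-unique n

mutual
  points-unique : ∀ d n → Unique (points d n)
  points-unique zero    n = evens-unique n
  points-unique (suc d) n = Unique.++⁺ (Unique.map⁺ ∷-injectiveʳ (points-unique d n)) (shell-unique d n 0) disjoint
    where
    disjoint : Disjoint (map (+ 0 ∷_) (points d n)) (shell d n 0)
    disjoint {t ∷ y} (x∈₀ , x∈shell) with ∈-map-∷⁻ x∈₀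
    ... | refl , _ = ℕ.n≮0 (proj₁ (∈shell⇒ d n 0 t y x∈shell))

  shell-unique : ∀ d r a → Unique (shell d r a)
  shell-unique d zero    a = []
  shell-unique d (suc r) a =
    Unique.++⁺ (Unique.map⁺ ∷-injectiveʳ (points-unique d r))
      (Unique.++⁺ (Unique.map⁺ ∷-injectiveʳ (points-unique d r)) (shell-unique d r (suc a)) disjoint₋)
      disjoint₊
    where
    disjoint₋ : Disjoint (map (-[1+ a ] ∷_) (points d r)) (shell d r (suc a))
    disjoint₋ {t ∷ y} (x∈₋ , x∈deeper) with ∈-map-∷⁻ x∈₋
    ... | refl , _ = ℕ.<-irrefl refl (proj₁ (∈shell⇒ d r (suc a) t y x∈deeper))
    disjoint₊ : Disjoint (map (+ suc a ∷_) (points d r)) (map (-[1+ a ] ∷_) (points d r) ++ shell d r (suc a))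
    disjoint₊ {t ∷ y} (x∈₊ , x∈′) with ∈-map-∷⁻ x∈₊ | ∈-++⁻ (map (-[1+ a ] ∷_) (points d r)) x∈′
    ... | refl , _ | inj₁ x∈₋ with ∈-map-∷⁻ x∈₋
    ...   | () , _
    disjoint₊ {t ∷ y} (x∈₊ , x∈′) | refl , _ | inj₂ x∈deeper = ℕ.<-irrefl refl (proj₁ (∈shell⇒ d r (suc a) t y x∈deeper))

#points : ℕ → ℕ → ℚ
#points d n = ℕ→ℚ (length (points d n))

length-shell : ∀ d r a → ℕ→ℚ (length (shell d r a)) ≡ ℕ→ℚ 2 * Σ< r (#points d)
length-shell d zero    a = refl
length-shell d (suc r) a = begin
  ℕ→ℚ (length (map (+ suc a ∷_) P ++ map (-[1+ a ] ∷_) P ++ shell d r (suc a)))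
    ≡⟨ cong ℕ→ℚ (List.length-++ (map (+ suc a ∷_) P)) ⟩
  ℕ→ℚ (length (map (+ suc a ∷_) P) ℕ.+ length (map (-[1+ a ] ∷_) P ++ shell d r (suc a)))
    ≡⟨ cong ℕ→ℚ (cong₂ ℕ._+_ (List.length-map _ P) (trans (List.length-++ (map (-[1+ a ] ∷_) P)) (cong (ℕ._+ length (shell d r (suc a))) (List.length-map _ P)))) ⟩
  ℕ→ℚ (length P ℕ.+ (length P ℕ.+ length (shell d r (suc a))))
    ≡⟨ trans (ℕ→ℚ-+ (length P) _) (cong (_+_ (#points d r)) (ℕ→ℚ-+ (length P) _)) ⟩
  #points d r + (#points d r + ℕ→ℚ (length (shell d r (suc a))))
    ≡⟨ cong (λ s → #points d r + (#points d r + s)) (length-shell d r (suc a)) ⟩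
  #points d r + (#points d r + ℕ→ℚ 2 * Σ< r (#points d))
    ≡⟨ solve 2 (λ p s → p :+ (p :+ con (ℕ→ℚ 2) :* s) := con (ℕ→ℚ 2) :* (s :+ p)) refl (#points d r) (Σ< r (#points d)) ⟩
  ℕ→ℚ 2 * Σ< (suc r) (#points d)
    ∎
  where
  open ≡-Reasoning
  P = points d r

#points-suc : ∀ d n → #points (suc d) n ≡ #points d n + ℕ→ℚ 2 * Σ< n (#points d)
#points-suc d n = begin
  ℕ→ℚ (length (map (+ 0 ∷_) (points d n) ++ shell d n 0))
    ≡⟨ cong ℕ→ℚ (trans (List.length-++ (map (+ 0 ∷_) (points d n))) (cong (ℕ._+ length (shell d n 0)) (List.length-map _ (points d n)))) ⟩
  ℕ→ℚ (length (points d n) ℕ.+ length (shell d n 0))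
    ≡⟨ ℕ→ℚ-+ (length (points d n)) _ ⟩
  #points d n + ℕ→ℚ (length (shell d n 0))
    ≡⟨ cong (_+_ (#points d n)) (length-shell d n 0) ⟩
  #points d n + ℕ→ℚ 2 * Σ< n (#points d)
    ∎
  where open ≡-Reasoning

#points-1 : ∀ n → #points 1 n ≡ ℕ→ℚ n + 1ℚ
#points-1 n = trans (#points-suc 0 n) (lines n)
  where
  parity : ∀ n → #points 0 n + #points 0 (suc n) ≡ 1ℚ
  parity zero          = refl
  parity (suc zero)    = refl
  parity (suc (suc n)) = parity n
  lines : ∀ n → #points 0 n + ℕ→ℚ 2 * Σ< n (#points 0) ≡ ℕ→ℚ n + 1ℚ
  lines zero    = refl
  lines (suc n) = begin
    #points 0 (suc n) + ℕ→ℚ 2 * (Σ< n (#points 0) + #points 0 n)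
      ≡⟨ solve 3 (λ e o s → o :+ con (ℕ→ℚ 2) :* (s :+ e) := (e :+ con (ℕ→ℚ 2) :* s) :+ (e :+ o)) refl (#points 0 n) (#points 0 (suc n)) (Σ< n (#points 0)) ⟩
    (#points 0 n + ℕ→ℚ 2 * Σ< n (#points 0)) + (#points 0 n + #points 0 (suc n))
      ≡⟨ cong₂ _+_ (lines n) (parity n) ⟩
    ℕ→ℚ n + 1ℚ + 1ℚ
      ≡⟨ cong (_+ 1ℚ) (ℕ→ℚ-suc n) ⟨
    ℕ→ℚ (suc n) + 1ℚ
      ∎
    where open ≡-Reasoning

#points≡cardinalityPoly : ∀ k n → #points (suc k) n ≡ cardinalityPoly k n
#points≡cardinalityPoly zero    n = trans (#points-1 n)
  (solve 1 (λ x → x :+ con 1ℚ := con 0ℚ :+ con 1ℚ :* con 1ℚ :+ con 1ℚ :* (x :* con 1ℚ)) refl (ℕ→ℚ n))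
#points≡cardinalityPoly (suc k) n = begin
  #points (suc (suc k)) n                                        ≡⟨ #points-suc (suc k) n ⟩
  #points (suc k) n + ℕ→ℚ 2 * Σ< n (#points (suc k))             ≡⟨ cong₂ (λ a s → a + ℕ→ℚ 2 * s) (#points≡cardinalityPoly k n) (Σ<-cong n (λ i _ → #points≡cardinalityPoly k i)) ⟩
  cardinalityPoly k n + ℕ→ℚ 2 * Σ< n (cardinalityPoly k)         ≡⟨ cardinalityPoly-suc k n ⟨
  cardinalityPoly (suc k) n                                      ∎
  where open ≡-Reasoning

theorem1 : (d : ℕ) .{{_ : NonZero d}} (n : ℕ) →
    Σ (List (Vecℤ d)) (λ xs →
      Unique xs ×
      ((x : Vecℤ d) → (x ∈ xs) ⇔ InP d n x) ×
      (ℕ→ℚ (length xs) ≡ sumTo d (λ p → c d p * ℕ→ℚ (n ^ p))))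
theorem1 (suc k) n = points (suc k) n , points-unique (suc k) n , membership , count
  where
  membership : (x : Vecℤ (suc k)) → (x ∈ points (suc k) n) ⇔ InP (suc k) n x
  membership x = ⇔.trans (∈points⇔Reachable (suc k) x) (⇔.sym (InP⇔Reachable x))
  count : #points (suc k) n ≡ sumTo (suc k) (λ p → c' k p * ℕ→ℚ (n ^ p))
  count = begin
    #points (suc k) n                                           ≡⟨ #points≡cardinalityPoly k n ⟩
    cardinalityPoly k n                                         ≡⟨ Σ<-cong (suc (suc k)) (λ p _ → cong (c' k p *_) (ℕ→ℚ-^ n p)) ⟨
    Σ< (suc (suc k)) (λ p → c' k p * ℕ→ℚ (n ^ p))               ≡⟨ sumTo≡Σ< (suc k) _ ⟨
    sumTo (suc k) (λ p → c' k p * ℕ→ℚ (n ^ p))                  ∎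
    where open ≡-Reasoning
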